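{- Let $N$ be a positive integer, $d\ge 3$, and let $a,p,m,k$ be nonzero integers such that $\gcd(m,p)=1$, $\gcd(ap,N)=1$ and $(am^d-kN)/p^2$ is a nonzero integer. Let $$[c_0,\dots,c_{d+1}]=\left[ap^{d-1},ap^{d-2}m,\dots,am^{d-1},\frac{am^d-kN}{p},\frac{m(am^d-kN)}{p^2}\right],$$ and define $\tilde{a}=a/\gcd(a,c_d/p)$ and $\tilde{k}=k/\gcd(a,c_d/p)$. Then for any degree $d$ integer polynomial $\tilde{f}=\sum_{i=0}^d\tilde{a}_ix^i$ with $\tilde{a}_d=\tilde{a}$, $\tilde{a}_{d-1}=0$ and $\tilde{f}(m/p)p^d=\tilde{k}N$, a vector $(a_0,\dots,a_d)\in\mathbb{Z}^{d+1}$ is orthogonal to both $[c_0,\dots,c_d]$ and $[c_1,\dots,c_{d+1}]$ if and only if there exist integers $r_0,\dots,r_{d-2}$ such that $$\sum_{i=0}^{d}a_ix^i=r_{d-2}\tilde{f}(x)+(px-m)\sum_{i=0}^{d-3}r_ix^i.$$ Moreover, such a polynomial $\tilde{f}$ exists and can be computed with Algorithm A.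
   Context: Orthogonality is with respect to the standard inner product on $\mathbb{Z}^{d+1}$. Algorithm A. Input: nonzero integers $m,p,\tilde{k},N$ with $\gcd(m,p)=1$, and integers $a_j,\dots,a_n$ with $1\le j\le n$ such that $p^{n-j+1}$ divides $\tilde{k}N-\sum_{i=j}^{n}a_im^ip^{n-i}$. Output: an integer polynomial $\sum_{i=0}^n a_ix^i$ taking value $\tilde{k}N$ after evaluation at $m/p$ and multiplication by $p^n$. Steps: (1) If $j=n$ set $r_j=\tilde{k}N$; otherwise $r_j=\left(\tilde{k}N-\sum_{i=j+1}^{n}a_im^ip^{n-i}\right)/p^{n-j}$. (2) For $i=j-1,\dots,0$ compute $r_i=(r_{i+1}-a_{i+1}m^{i+1})/p$ and $a_i=(r_i+t_ip)/m^i$, where $t_i\in[-m^i/2,m^i/2)\cap\mathbb{Z}$, $t_i\equiv -r_i/p\pmod{m^i}$. (3) Return $\sum_{i=0}^n a_ix^i$. -}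

module Defs where

open import Data.Nat as ℕ using (ℕ; zero; suc; _∸_; _<ᵇ_; _≡ᵇ_; _<?_)
open import Data.Integer using (ℤ; +_; 0ℤ; 1ℤ; _+_; _-_; _*_; _^_; -_; ∣_∣; _≤_; _<_)
open import Data.Integer.Divisibility using (_∣_)
open import Data.Fin using (Fin; fromℕ<; toℕ; fromℕ)
open import Data.Bool using (if_then_else_)
open import Data.Product using (_×_)
open import Relation.Nullary using (yes; no)
open import Relation.Binary.PropositionalEquality using (_≡_)

Σ< : ℕ → (ℕ → ℤ) → ℤ
Σ< zero    f = 0ℤ
Σ< (suc n) f = Σ< n f + f n

ext : ∀ {n} → (Fin n → ℤ) → ℕ → ℤ
ext {n} v i with i <? n
... | yes h = v (fromℕ< h)
... | no  _ = 0ℤ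

inner : (d : ℕ) → (Fin (suc d) → ℤ) → (ℕ → ℤ) → ℤ
inner d v c = Σ< (suc d) (λ i → ext v i * c i)

-- [c_0,…,c_{d+1}] where q = (a m^d - k N)/p^2, so c_d = (a m^d - kN)/p = p q
-- and c_{d+1} = m (a m^d - kN)/p^2 = m q.
cvec : (d : ℕ) (a p m q : ℤ) → ℕ → ℤ
cvec d a p m q i =
  if i <ᵇ d then a * p ^ (d ∸ 1 ∸ i) * m ^ i
  else if i ≡ᵇ d then p * q
  else m * q

shift : (ℕ → ℤ) → ℕ → ℤ
shift c i = c (suc i)

-- p^n f(m/p) for f = Σ_{i≤n} f_i x^i, i.e. Σ_{i=0}^n f_i m^i p^{n-i}
homEval : (n : ℕ) → (Fin (suc n) → ℤ) → (m p : ℤ) → ℤ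
homEval n f m p = Σ< (suc n) (λ i → ext f i * m ^ i * p ^ (n ∸ i))

IsFtilde : (d : ℕ) (at m p kt N : ℤ) → (Fin (suc d) → ℤ) → Set
IsFtilde d at m p kt N f =
  f (fromℕ d) ≡ at × ext f (d ∸ 1) ≡ 0ℤ × homEval d f m p ≡ kt * N

-- coefficient sequence of (p x - m) * s(x)
linMul : (p m : ℤ) → (ℕ → ℤ) → ℕ → ℤ
linMul p m s zero    = - (m * s zero)
linMul p m s (suc i) = p * s i - m * s (suc i)

trunc : ℕ → (ℕ → ℤ) → ℕ → ℤ
trunc n s i = if i <ᵇ n then s i else 0ℤ

PolyRel : (d : ℕ) (p m : ℤ) (f v : Fin (suc d) → ℤ) (r : Fin (d ∸ 1) → ℤ) → Set
PolyRel d p m f v r =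
  ∀ i → ext v i ≡ ext r (d ∸ 2) * ext f i + linMul p m (trunc (d ∸ 2) (ext r)) i

-- A run (execution trace) of Algorithm A on input m, p, K (= k̃N), n, j and the
-- given coefficients aIn j … aIn n.  A, R, T record the values a_i, r_i, t_i.
-- Step (1) is written uniformly: r_j p^{n-j} = K - Σ_{i=j+1}^n a_i m^i p^{n-i}
-- (for j = n this reads r_n = K).  Exact divisions are written as products.
-- t_i ∈ [-|m^i|/2, |m^i|/2) and t_i ≡ -r_i/p (mod m^i), i.e. m^i ∣ p t_i + r_i.
record AlgARun (m p K : ℤ) (n j : ℕ) (aIn : ℕ → ℤ) (A R T : ℕ → ℤ) : Set where
  field
    inputs : ∀ i → j ℕ.≤ i → i ℕ.≤ n → A i ≡ aIn i
    step1  : R j * p ^ (n ∸ j)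
               ≡ K - Σ< (n ∸ j) (λ t → aIn (suc j ℕ.+ t) * m ^ (suc j ℕ.+ t) * p ^ (n ∸ (suc j ℕ.+ t)))
    stepR  : ∀ i → i ℕ.< j → p * R i ≡ R (suc i) - A (suc i) * m ^ (suc i)
    stepTlo : ∀ i → i ℕ.< j → - (+ ∣ m ^ i ∣) ≤ + 2 * T i
    stepThi : ∀ i → i ℕ.< j → + 2 * T i < + ∣ m ^ i ∣
    stepTcong : ∀ i → i ℕ.< j → (m ^ i) ∣ (p * T i + R i)
    stepA  : ∀ i → i ℕ.< j → m ^ i * A i ≡ R i + T i * p

algOut : (n : ℕ) → (ℕ → ℤ) → Fin (suc n) → ℤ
algOut n A i = A (toℕ i)

inputCoeffs : (d : ℕ) (at : ℤ) → ℕ → ℤ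
inputCoeffs d at i = if i ≡ᵇ d then at else 0ℤ

{-# OPTIONS --safe #-}
-- Write X(v) = Σ_{i≤d−2} v_i m^i p^(d−2−i) for the homogenised value at m/p of the low part of v.
-- The two inner products are a (p X + v_(d−1) m^(d−1)) + v_d p q and a m X + v_(d−1) p q + v_d m q;
-- m times the first minus p times the second is v_(d−1) k N, so orthogonality forces v_(d−1) = 0.
-- Dividing by g = gcd(a, q) leaves ã X + q̃ v_d = 0 with ã, q̃ coprime, hence (v_(d−1), v_d, X) is
-- ρ (0, ã, −q̃), which is exactly the corresponding data of ρ f̃. Then v − ρ f̃ has degree ≤ d − 2
-- and vanishes at m/p, and since gcd(m, p) = 1 synthetic division by p x − m produces r_0 … r_(d−3),
-- with r_(d−2) = ρ; the converse is a direct computation.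
-- Algorithm A keeps r_i = Σ_{l≤i} a_l m^l p^(i−l); splitting the sum defining f̃(m/p) p^d at index j
-- and using step (1) gives k̃ N. The balanced t_i exist because p is invertible modulo m^i.
module Submission where

open import Defs
open import Data.Bool using (true; false; if_then_else_)
import Data.Bool as Bool
open import Data.Empty using (⊥-elim)
open import Data.Fin using (Fin; fromℕ<; toℕ; fromℕ)
import Data.Fin.Properties as Fin
open import Data.Integer
  using (ℤ; +_; -[1+_]; 0ℤ; 1ℤ; -1ℤ; _+_; _-_; _*_; _^_; -_; ∣_∣; _≤_; _<_; +≤+; +<+; -≤-; ≢-nonZero)
import Data.Integer.Properties as ℤ
import Data.Integer.DivMod as ZD
open import Data.Integer.Divisibility.Signed using (divides; ∣⇒∣ᵤ; ∣ᵤ⇒∣; _∣_; module _∣_)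
open import Data.Integer.Tactic.RingSolver using (solve-∀)
open import Data.Nat as ℕ using (ℕ; zero; suc; _∸_; _<ᵇ_; _≡ᵇ_; _<?_; s≤s)
import Data.Nat.Properties as ℕ
open import Data.Product using (_×_; _,_; proj₁; proj₂; ∃-syntax)
open import Data.Sum using (inj₁; inj₂)
open import Data.Integer.GCD using (gcd; gcd[i,j]∣j; gcd[i,j]≡0⇒i≡0)
import Data.Nat.GCD as ℕGCD
open import Data.Unit using (tt)
open import Relation.Nullary using (yes; no)
open import Relation.Binary.PropositionalEquality
open import Function using (_∘_; _$_)
open import Function.Bundles using (_⇔_; mk⇔)
import Function.Properties.Equivalence as ⇔
open ≡-Reasoning

<ᵇ-true : ∀ {i n} → i ℕ.< n → (i <ᵇ n) ≡ true
<ᵇ-true {i} {n} i<n with i <ᵇ n in eq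
... | true  = refl
... | false = ⊥-elim (subst Bool.T eq (ℕ.<⇒<ᵇ i<n))

<ᵇ-false : ∀ {i n} → n ℕ.≤ i → (i <ᵇ n) ≡ false
<ᵇ-false {i} {n} n≤i with i <ᵇ n in eq
... | true  = ⊥-elim (ℕ.<⇒≱ (ℕ.<ᵇ⇒< i n (subst Bool.T (sym eq) tt)) n≤i)
... | false = refl

≡ᵇ-true : ∀ n → (n ≡ᵇ n) ≡ true
≡ᵇ-true n with n ≡ᵇ n in eq
... | true  = refl
... | false = ⊥-elim (subst Bool.T eq (ℕ.≡⇒≡ᵇ n n refl))

≡ᵇ-false : ∀ {i n} → i ≢ n → (i ≡ᵇ n) ≡ false
≡ᵇ-false {i} {n} i≢n with i ≡ᵇ n in eq
... | true  = ⊥-elim (i≢n (ℕ.≡ᵇ⇒≡ i n (subst Bool.T (sym eq) tt)))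
... | false = refl

ext-< : ∀ {n} (v : Fin n → ℤ) {i} (i<n : i ℕ.< n) → ext v i ≡ v (fromℕ< i<n)
ext-< {n} v {i} i<n with i <? n
... | yes i<n′ = cong v (Fin.fromℕ<-cong i i refl i<n′ i<n)
... | no  i≮n  = ⊥-elim (i≮n i<n)

ext-≥ : ∀ {n} (v : Fin n → ℤ) {i} → n ℕ.≤ i → ext v i ≡ 0ℤ
ext-≥ {n} v {i} n≤i with i <? n
... | yes i<n = ⊥-elim (ℕ.<⇒≱ i<n n≤i)
... | no  _   = refl

ext-toℕ : ∀ {n} (v : Fin n → ℤ) (j : Fin n) → ext v (toℕ j) ≡ v j
ext-toℕ v j = trans (ext-< v (Fin.toℕ<n j)) (cong v (Fin.fromℕ<-toℕ j (Fin.toℕ<n j)))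

ext-fromℕ : ∀ n (v : Fin (suc n) → ℤ) → ext v n ≡ v (fromℕ n)
ext-fromℕ n v = trans (cong (ext v) (sym (Fin.toℕ-fromℕ n))) (ext-toℕ v (fromℕ n))

Σ<-cong : ∀ n {f g : ℕ → ℤ} → (∀ {i} → i ℕ.< n → f i ≡ g i) → Σ< n f ≡ Σ< n g
Σ<-cong zero    f≗g = refl
Σ<-cong (suc n) f≗g = cong₂ _+_ (Σ<-cong n (λ i<n → f≗g (ℕ.m<n⇒m<1+n i<n))) (f≗g ℕ.≤-refl)

*-Σ< : ∀ c n (f : ℕ → ℤ) → c * Σ< n f ≡ Σ< n (λ i → c * f i)
*-Σ< c zero    f = ℤ.*-zeroʳ c
*-Σ< c (suc n) f = trans (ℤ.*-distribˡ-+ c (Σ< n f) (f n)) (cong (_+ c * f n) (*-Σ< c n f))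

Σ<-+ : ∀ a b (f : ℕ → ℤ) → Σ< (a ℕ.+ b) f ≡ Σ< a f + Σ< b (λ t → f (a ℕ.+ t))
Σ<-+ a zero    f = trans (cong (λ k → Σ< k f) (ℕ.+-identityʳ a)) (sym (ℤ.+-identityʳ (Σ< a f)))
Σ<-+ a (suc b) f = begin
  Σ< (a ℕ.+ suc b) f                                   ≡⟨ cong (λ k → Σ< k f) (ℕ.+-suc a b) ⟩
  Σ< (a ℕ.+ b) f + f (a ℕ.+ b)                          ≡⟨ cong (_+ f (a ℕ.+ b)) (Σ<-+ a b f) ⟩
  Σ< a f + Σ< b (λ t → f (a ℕ.+ t)) + f (a ℕ.+ b)        ≡⟨ ℤ.+-assoc (Σ< a f) _ _ ⟩
  Σ< a f + Σ< (suc b) (λ t → f (a ℕ.+ t))               ∎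

-- horner m p k e = Σ_{i<k} e_i m^i p^(k−1−i) = p^(k−1) (e_0 + … + e_(k−1) x^(k−1)) at x = m/p
horner : ℤ → ℤ → ℕ → (ℕ → ℤ) → ℤ
horner m p zero    e = 0ℤ
horner m p (suc k) e = p * horner m p k e + e k * m ^ k

module _ (m p : ℤ) where

  horner-cong : ∀ k {e e′ : ℕ → ℤ} → (∀ {i} → i ℕ.< k → e i ≡ e′ i) →
                horner m p k e ≡ horner m p k e′
  horner-cong zero    e≗e′ = refl
  horner-cong (suc k) e≗e′ =
    cong₂ (λ h c → p * h + c * m ^ k) (horner-cong k (λ i<k → e≗e′ (ℕ.m<n⇒m<1+n i<k))) (e≗e′ ℕ.≤-refl)

  horner-linear : ∀ k ρ (e₁ e₂ : ℕ → ℤ) →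
                  horner m p k (λ i → ρ * e₁ i + e₂ i) ≡ ρ * horner m p k e₁ + horner m p k e₂
  horner-linear zero    ρ e₁ e₂ = sym (cong (_+ 0ℤ) (ℤ.*-zeroʳ ρ))
  horner-linear (suc k) ρ e₁ e₂ = begin
    p * horner m p k (λ i → ρ * e₁ i + e₂ i) + (ρ * e₁ k + e₂ k) * m ^ k
      ≡⟨ cong (λ h → p * h + (ρ * e₁ k + e₂ k) * m ^ k) (horner-linear k ρ e₁ e₂) ⟩
    p * (ρ * horner m p k e₁ + horner m p k e₂) + (ρ * e₁ k + e₂ k) * m ^ k
      ≡⟨ regroup p ρ (horner m p k e₁) (horner m p k e₂) (e₁ k) (e₂ k) (m ^ k) ⟩
    ρ * (p * horner m p k e₁ + e₁ k * m ^ k) + (p * horner m p k e₂ + e₂ k * m ^ k) ∎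
    where
    regroup : ∀ p ρ h₁ h₂ c₁ c₂ x →
              p * (ρ * h₁ + h₂) + (ρ * c₁ + c₂) * x ≡ ρ * (p * h₁ + c₁ * x) + (p * h₂ + c₂ * x)
    regroup = solve-∀

  -- (p x − m) s(x) vanishes at m/p, up to the boundary term from truncating s
  horner-linMul : ∀ k (s : ℕ → ℤ) → horner m p (suc k) (linMul p m s) ≡ - (m ^ suc k * s k)
  horner-linMul zero    s = base p m (s 0)
    where
    base : ∀ p m s → p * 0ℤ + - (m * s) * 1ℤ ≡ - (m * 1ℤ * s)
    base = solve-∀
  horner-linMul (suc k) s = begin
    p * horner m p (suc k) (linMul p m s) + (p * s k - m * s (suc k)) * m ^ suc k
      ≡⟨ cong (λ h → p * h + (p * s k - m * s (suc k)) * m ^ suc k) (horner-linMul k s) ⟩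
    p * - (m ^ suc k * s k) + (p * s k - m * s (suc k)) * m ^ suc k
      ≡⟨ telescope p m (m ^ suc k) (s k) (s (suc k)) ⟩
    - (m * m ^ suc k * s (suc k)) ∎
    where
    telescope : ∀ p m x s₀ s₁ → p * - (x * s₀) + (p * s₀ - m * s₁) * x ≡ - (m * x * s₁)
    telescope = solve-∀

  horner-lowest : ∀ k (e : ℕ → ℤ) →
                  horner m p (suc k) e ≡ p ^ k * e 0 + m * horner m p k (λ i → e (suc i))
  horner-lowest zero    e = base p (e 0) m
    where
    base : ∀ p e₀ m → p * 0ℤ + e₀ * 1ℤ ≡ 1ℤ * e₀ + m * 0ℤ
    base = solve-∀
  horner-lowest (suc k) e = begin
    p * horner m p (suc k) e + e (suc k) * m ^ suc k
      ≡⟨ cong (λ h → p * h + e (suc k) * m ^ suc k) (horner-lowest k e) ⟩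
    p * (p ^ k * e 0 + m * horner m p k (λ i → e (suc i))) + e (suc k) * m ^ suc k
      ≡⟨ regroup p (e 0) (p ^ k) m (horner m p k (λ i → e (suc i))) (e (suc k)) (m ^ k) ⟩
    p ^ suc k * e 0 + m * horner m p (suc k) (λ i → e (suc i)) ∎
    where
    regroup : ∀ p e₀ y m h c x → p * (y * e₀ + m * h) + c * (m * x) ≡ p * y * e₀ + m * (p * h + c * x)
    regroup = solve-∀

  Σ<-horner : ∀ k (e : ℕ → ℤ) → Σ< k (λ i → e i * m ^ i * p ^ (k ∸ suc i)) ≡ horner m p k e
  Σ<-horner zero    e = refl
  Σ<-horner (suc k) e = begin
    Σ< k (λ i → e i * m ^ i * p ^ (suc k ∸ suc i)) + e k * m ^ k * p ^ (k ∸ k)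
      ≡⟨ cong₂ _+_ (Σ<-cong k shift-exponent) (cong (λ t → e k * m ^ k * p ^ t) (ℕ.n∸n≡0 k)) ⟩
    Σ< k (λ i → p * (e i * m ^ i * p ^ (k ∸ suc i))) + e k * m ^ k * 1ℤ
      ≡⟨ cong₂ _+_ (sym (*-Σ< p k _)) (ℤ.*-identityʳ (e k * m ^ k)) ⟩
    p * Σ< k (λ i → e i * m ^ i * p ^ (k ∸ suc i)) + e k * m ^ k
      ≡⟨ cong (λ h → p * h + e k * m ^ k) (Σ<-horner k e) ⟩
    p * horner m p k e + e k * m ^ k ∎
    where
    shift-exponent : ∀ {i} → i ℕ.< k → e i * m ^ i * p ^ (k ∸ i) ≡ p * (e i * m ^ i * p ^ (k ∸ suc i))
    shift-exponent {i} i<k = begin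
      e i * m ^ i * p ^ (k ∸ i)           ≡⟨ cong (λ t → e i * m ^ i * p ^ t) (ℕ.+-∸-assoc 1 i<k) ⟩
      e i * m ^ i * (p * p ^ (k ∸ suc i)) ≡⟨ rotate (e i) (m ^ i) p (p ^ (k ∸ suc i)) ⟩
      p * (e i * m ^ i * p ^ (k ∸ suc i)) ∎
      where
      rotate : ∀ a b c d → a * b * (c * d) ≡ c * (a * b * d)
      rotate = solve-∀

  homEval-horner : ∀ n (f : Fin (suc n) → ℤ) → homEval n f m p ≡ horner m p (suc n) (ext f)
  homEval-horner n f = Σ<-horner (suc n) (ext f)

module _ (d : ℕ) (a p m q : ℤ) where

  cvec-< : ∀ {i} → i ℕ.< d → cvec d a p m q i ≡ a * p ^ (d ∸ suc i) * m ^ i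
  cvec-< {i} i<d rewrite <ᵇ-true i<d = cong (λ t → a * p ^ t * m ^ i) (ℕ.∸-+-assoc d 1 i)

  cvec-d : cvec d a p m q d ≡ p * q
  cvec-d rewrite <ᵇ-false (ℕ.≤-refl {d}) | ≡ᵇ-true d = refl

  cvec-d+1 : cvec d a p m q (suc d) ≡ m * q
  cvec-d+1 rewrite <ᵇ-false (ℕ.n≤1+n d) | ≡ᵇ-false (ℕ.1+n≢n {d}) = refl

  cvec-scale : ∀ g i → cvec d (a * g) p m (q * g) i ≡ g * cvec d a p m q i
  cvec-scale g i with i <ᵇ d | i ≡ᵇ d
  ... | true  | _     = scale₃ a g (p ^ (d ∸ 1 ∸ i)) (m ^ i)
    where
    scale₃ : ∀ a g x y → a * g * x * y ≡ g * (a * x * y)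
    scale₃ = solve-∀
  ... | false | true  = scale₂ p q g
    where
    scale₂ : ∀ p q g → p * (q * g) ≡ g * (p * q)
    scale₂ = solve-∀
  ... | false | false = scale₂ m q g
    where
    scale₂ : ∀ m q g → m * (q * g) ≡ g * (m * q)
    scale₂ = solve-∀

inner-scaled : ∀ d (v : Fin (suc d) → ℤ) g {c c′ : ℕ → ℤ} → (∀ i → c′ i ≡ g * c i) →
               inner d v c′ ≡ g * inner d v c
inner-scaled d v g {c} {c′} c′≡gc = begin
  Σ< (suc d) (λ i → ext v i * c′ i)       ≡⟨ Σ<-cong (suc d) (λ {i} _ → trans (cong (ext v i *_) (c′≡gc i)) (swap (ext v i) g (c i))) ⟩
  Σ< (suc d) (λ i → g * (ext v i * c i))  ≡⟨ *-Σ< g (suc d) _ ⟨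
  g * inner d v c                         ∎
  where
  swap : ∀ x g c → x * (g * c) ≡ g * (x * c)
  swap = solve-∀

inner-cvec : ∀ d (a p m q : ℤ) (v : Fin (suc d) → ℤ) →
             inner d v (cvec d a p m q) ≡ a * horner m p d (ext v) + ext v d * (p * q)
inner-cvec d a p m q v = cong₂ _+_ body (cong (ext v d *_) (cvec-d d a p m q))
  where
  term : ∀ {i} → i ℕ.< d → ext v i * cvec d a p m q i ≡ a * (ext v i * m ^ i * p ^ (d ∸ suc i))
  term {i} i<d = trans (cong (ext v i *_) (cvec-< d a p m q i<d)) (rearrange (ext v i) a (p ^ (d ∸ suc i)) (m ^ i))
    where
    rearrange : ∀ x a y z → x * (a * y * z) ≡ a * (x * z * y)
    rearrange = solve-∀
  body : Σ< d (λ i → ext v i * cvec d a p m q i) ≡ a * horner m p d (ext v)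
  body = begin
    Σ< d (λ i → ext v i * cvec d a p m q i)            ≡⟨ Σ<-cong d term ⟩
    Σ< d (λ i → a * (ext v i * m ^ i * p ^ (d ∸ suc i))) ≡⟨ *-Σ< a d _ ⟨
    a * Σ< d (λ i → ext v i * m ^ i * p ^ (d ∸ suc i))   ≡⟨ cong (a *_) (Σ<-horner m p d (ext v)) ⟩
    a * horner m p d (ext v)                             ∎

inner-shift-cvec : ∀ k (a p m q : ℤ) (v : Fin (suc (suc k)) → ℤ) →
                   inner (suc k) v (shift (cvec (suc k) a p m q))
                     ≡ a * m * horner m p k (ext v) + ext v k * (p * q) + ext v (suc k) * (m * q)
inner-shift-cvec k a p m q v =
  cong₂ _+_ (cong₂ _+_ body (cong (ext v k *_) (cvec-d (suc k) a p m q)))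
            (cong (ext v (suc k) *_) (cvec-d+1 (suc k) a p m q))
  where
  term : ∀ {i} → i ℕ.< k → ext v i * cvec (suc k) a p m q (suc i) ≡ a * m * (ext v i * m ^ i * p ^ (k ∸ suc i))
  term {i} i<k = trans (cong (ext v i *_) (cvec-< (suc k) a p m q (s≤s i<k)))
                       (rearrange (ext v i) a (p ^ (k ∸ suc i)) m (m ^ i))
    where
    rearrange : ∀ x a y m z → x * (a * y * (m * z)) ≡ a * m * (x * z * y)
    rearrange = solve-∀
  body : Σ< k (λ i → ext v i * cvec (suc k) a p m q (suc i)) ≡ a * m * horner m p k (ext v)
  body = begin
    Σ< k (λ i → ext v i * cvec (suc k) a p m q (suc i))      ≡⟨ Σ<-cong k term ⟩
    Σ< k (λ i → a * m * (ext v i * m ^ i * p ^ (k ∸ suc i))) ≡⟨ *-Σ< (a * m) k _ ⟨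
    a * m * Σ< k (λ i → ext v i * m ^ i * p ^ (k ∸ suc i))   ≡⟨ cong (a * m *_) (Σ<-horner m p k (ext v)) ⟩
    a * m * horner m p k (ext v)                             ∎

i*j≡0⇒j≡0 : ∀ {i j} → i ≢ 0ℤ → i * j ≡ 0ℤ → j ≡ 0ℤ
i*j≡0⇒j≡0 {i} i≢0 ij≡0 with ℤ.i*j≡0⇒i≡0∨j≡0 i ij≡0
... | inj₁ i≡0 = ⊥-elim (i≢0 i≡0)
... | inj₂ j≡0 = j≡0

*-≢0 : ∀ {i j} → i ≢ 0ℤ → j ≢ 0ℤ → i * j ≢ 0ℤ
*-≢0 {i} i≢0 j≢0 ij≡0 = j≢0 (i*j≡0⇒j≡0 i≢0 ij≡0)

record BézoutIdentity (g a b : ℤ) : Set where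
  constructor bézoutIdentity
  field
    u w      : ℤ
    identity : u * a + w * b ≡ g

abs-multiple : ∀ a → ∃[ σ ] (+ ∣ a ∣ ≡ σ * a)
abs-multiple a with ℤ.+∣i∣≡i⊎+∣i∣≡-i a
... | inj₁ ∣a∣≡a  = 1ℤ , trans ∣a∣≡a (sym (ℤ.*-identityˡ a))
... | inj₂ ∣a∣≡-a = -1ℤ , trans ∣a∣≡-a (sym (ℤ.-1*i≡-i a))

private
  toℤ : ∀ g x y m n → g ℕ.+ y ℕ.* n ≡ x ℕ.* m → + g + + y * + n ≡ + x * + m
  toℤ g x y m n eq = begin
    + g + + y * + n    ≡⟨ cong (λ t → + g + t) (ℤ.pos-* y n) ⟨
    + g + + (y ℕ.* n)  ≡⟨ ℤ.pos-+ g (y ℕ.* n) ⟨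
    + (g ℕ.+ y ℕ.* n)  ≡⟨ cong +_ eq ⟩
    + (x ℕ.* m)        ≡⟨ ℤ.pos-* x m ⟩
    + x * + m          ∎

  combine : ∀ g x y a b σa σb → + ∣ a ∣ ≡ σa * a → + ∣ b ∣ ≡ σb * b →
            g + y * + ∣ b ∣ ≡ x * + ∣ a ∣ → x * σa * a + - (y * σb) * b ≡ g
  combine g x y a b σa σb ∣a∣≡ ∣b∣≡ eq = begin
    x * σa * a + - (y * σb) * b      ≡⟨ regroup x σa a y σb b ⟩
    x * (σa * a) - y * (σb * b)      ≡⟨ cong₂ (λ s t → x * s - y * t) ∣a∣≡ ∣b∣≡ ⟨
    x * + ∣ a ∣ - y * + ∣ b ∣        ≡⟨ cong (_- y * + ∣ b ∣) eq ⟨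
    g + y * + ∣ b ∣ - y * + ∣ b ∣    ≡⟨ cancel g (y * + ∣ b ∣) ⟩
    g                                ∎
    where
    regroup : ∀ x σa a y σb b → x * σa * a + - (y * σb) * b ≡ x * (σa * a) - y * (σb * b)
    regroup = solve-∀
    cancel : ∀ g z → g + z - z ≡ g
    cancel = solve-∀

bézout : ∀ a b → BézoutIdentity (gcd a b) a b
bézout a b with ℕGCD.Bézout.identity (ℕGCD.gcd-GCD ∣ a ∣ ∣ b ∣) | abs-multiple a | abs-multiple b
... | ℕGCD.Bézout.+- x y eq | σa , ∣a∣≡ | σb , ∣b∣≡ =
  bézoutIdentity (+ x * σa) (- (+ y * σb)) $
    combine (gcd a b) (+ x) (+ y) a b σa σb ∣a∣≡ ∣b∣≡ (toℤ _ x y ∣ a ∣ ∣ b ∣ eq)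
... | ℕGCD.Bézout.-+ x y eq | σa , ∣a∣≡ | σb , ∣b∣≡ =
  bézoutIdentity (- (+ x * σa)) (+ y * σb) $
    trans (ℤ.+-comm (- (+ x * σa) * a) (+ y * σb * b))
          (combine (gcd a b) (+ y) (+ x) b a σb σa ∣b∣≡ ∣a∣≡ (toℤ _ y x ∣ b ∣ ∣ a ∣ eq))

bézout-sym : ∀ {g a b} → BézoutIdentity g a b → BézoutIdentity g b a
bézout-sym (bézoutIdentity u w eq) = bézoutIdentity w u $ trans (ℤ.+-comm (w * _) (u * _)) eq

bézout-* : ∀ {a b c} → BézoutIdentity 1ℤ a c → BézoutIdentity 1ℤ b c → BézoutIdentity 1ℤ (a * b) c
bézout-* {a} {b} {c} (bézoutIdentity u₁ w₁ eq₁) (bézoutIdentity u₂ w₂ eq₂) =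
  bézoutIdentity (u₁ * u₂) (w₁ * u₂ * b + w₂) (begin
  u₁ * u₂ * (a * b) + (w₁ * u₂ * b + w₂) * c   ≡⟨ regroup u₁ u₂ a b w₁ w₂ c ⟩
  (u₁ * a + w₁ * c) * (u₂ * b) + w₂ * c        ≡⟨ cong (λ t → t * (u₂ * b) + w₂ * c) eq₁ ⟩
  1ℤ * (u₂ * b) + w₂ * c                       ≡⟨ cong (_+ w₂ * c) (ℤ.*-identityˡ (u₂ * b)) ⟩
  u₂ * b + w₂ * c                              ≡⟨ eq₂ ⟩
  1ℤ                                           ∎)
  where
  regroup : ∀ u₁ u₂ a b w₁ w₂ c →
            u₁ * u₂ * (a * b) + (w₁ * u₂ * b + w₂) * c ≡ (u₁ * a + w₁ * c) * (u₂ * b) + w₂ * c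
  regroup = solve-∀

bézout-^ : ∀ {a c} → BézoutIdentity 1ℤ a c → ∀ i → BézoutIdentity 1ℤ (a ^ i) c
bézout-^ {c = c} B zero    = bézoutIdentity 1ℤ 0ℤ $ cong (λ t → 1ℤ + t) (ℤ.*-zeroˡ c)
bézout-^         B (suc i) = bézout-* B (bézout-^ B i)

bézout-/ : ∀ {g a b} → g ≢ 0ℤ → BézoutIdentity g (a * g) (b * g) → BézoutIdentity 1ℤ a b
bézout-/ {g} {a} {b} g≢0 (bézoutIdentity u w eq) = bézoutIdentity u w $ ℤ.*-cancelˡ-≡ g _ _ {{≢-nonZero g≢0}} (begin
  g * (u * a + w * b)        ≡⟨ regroup g u a w b ⟩
  u * (a * g) + w * (b * g)  ≡⟨ eq ⟩
  g                          ≡⟨ ℤ.*-identityʳ g ⟨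
  g * 1ℤ                     ∎)
  where
  regroup : ∀ g u a w b → g * (u * a + w * b) ≡ u * (a * g) + w * (b * g)
  regroup = solve-∀

coprime-kernel : ∀ {a b x y} → BézoutIdentity 1ℤ a b → a * x + b * y ≡ 0ℤ →
                 ∃[ ρ ] (x ≡ ρ * b × y ≡ - (ρ * a))
coprime-kernel {a} {b} {x} {y} (bézoutIdentity u w eq) ax+by≡0 = w * x - u * y , x≡ , y≡
  where
  x≡ : x ≡ (w * x - u * y) * b
  x≡ = begin
    x                                          ≡⟨ ℤ.*-identityʳ x ⟨
    x * 1ℤ                                     ≡⟨ cong (x *_) eq ⟨
    x * (u * a + w * b)                        ≡⟨ split u a w b x y ⟩
    u * (a * x + b * y) + (w * x - u * y) * b  ≡⟨ cong (λ t → u * t + (w * x - u * y) * b) ax+by≡0 ⟩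
    u * 0ℤ + (w * x - u * y) * b               ≡⟨ drop u ((w * x - u * y) * b) ⟩
    (w * x - u * y) * b                        ∎
    where
    drop : ∀ u z → u * 0ℤ + z ≡ z
    drop = solve-∀
    split : ∀ u a w b x y → x * (u * a + w * b) ≡ u * (a * x + b * y) + (w * x - u * y) * b
    split = solve-∀
  y≡ : y ≡ - ((w * x - u * y) * a)
  y≡ = begin
    y                                              ≡⟨ ℤ.*-identityʳ y ⟨
    y * 1ℤ                                         ≡⟨ cong (y *_) eq ⟨
    y * (u * a + w * b)                            ≡⟨ split u a w b x y ⟩
    w * (a * x + b * y) - (w * x - u * y) * a      ≡⟨ cong (λ t → w * t - (w * x - u * y) * a) ax+by≡0 ⟩
    w * 0ℤ - (w * x - u * y) * a                   ≡⟨ drop w ((w * x - u * y) * a) ⟩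
    - ((w * x - u * y) * a)                        ∎
    where
    drop : ∀ w z → w * 0ℤ - z ≡ - z
    drop = solve-∀
    split : ∀ u a w b x y → y * (u * a + w * b) ≡ w * (a * x + b * y) - (w * x - u * y) * a
    split = solve-∀

QuotientBy : ℤ → ℤ → ℕ → (ℕ → ℤ) → Set
QuotientBy p m k w = ∃[ s ] ((∀ {i} → k ℕ.≤ i → s i ≡ 0ℤ) × (∀ i → linMul p m s i ≡ w i))

-- synthetic division from the constant term: m ∣ p^k w₀ forces m ∣ w₀
px-m-divides : ∀ {m p} → BézoutIdentity 1ℤ m p → ∀ k (w : ℕ → ℤ) →
               (∀ {i} → k ℕ.< i → w i ≡ 0ℤ) → horner m p (suc k) w ≡ 0ℤ → QuotientBy p m k w
px-m-divides {m} {p} B zero w w-deg w-root = (λ _ → 0ℤ) , (λ _ → refl) , quotient-zero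
  where
  w₀≡0 : w 0 ≡ 0ℤ
  w₀≡0 = trans (sym (constant p (w 0))) w-root
    where
    constant : ∀ p c → p * 0ℤ + c * 1ℤ ≡ c
    constant = solve-∀
  quotient-zero : ∀ i → linMul p m (λ _ → 0ℤ) i ≡ w i
  quotient-zero zero    = trans (cong -_ (ℤ.*-zeroʳ m)) (sym w₀≡0)
  quotient-zero (suc i) = trans (vanish p m) (sym (w-deg (s≤s ℕ.z≤n)))
    where
    vanish : ∀ p m → p * 0ℤ - m * 0ℤ ≡ 0ℤ
    vanish = solve-∀
px-m-divides {m} {p} B (suc k) w w-deg w-root = s , s-deg , linMul-s
  where
  kernel : ∃[ ρ ] (w 0 ≡ ρ * m × horner m p (suc k) (λ i → w (suc i)) ≡ - (ρ * p ^ suc k))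
  kernel = coprime-kernel (bézout-^ (bézout-sym B) (suc k)) (trans (sym (horner-lowest m p (suc k) w)) w-root)

  ρ : ℤ
  ρ = proj₁ kernel

  w₀≡ : w 0 ≡ ρ * m
  w₀≡ = proj₁ (proj₂ kernel)

  tail≡ : horner m p (suc k) (λ i → w (suc i)) ≡ - (ρ * p ^ suc k)
  tail≡ = proj₂ (proj₂ kernel)

  -- w(x) − (p x − m)(− ρ) = x w′(x)
  w′ : ℕ → ℤ
  w′ zero    = w 1 + p * ρ
  w′ (suc i) = w (suc (suc i))

  w′-deg : ∀ {i} → k ℕ.< i → w′ i ≡ 0ℤ
  w′-deg {suc i} (s≤s k≤i) = w-deg (s≤s (s≤s k≤i))

  w′-root : horner m p (suc k) w′ ≡ 0ℤ
  w′-root = begin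
    horner m p (suc k) w′
      ≡⟨ horner-lowest m p k w′ ⟩
    p ^ k * (w 1 + p * ρ) + m * horner m p k (λ i → w (suc (suc i)))
      ≡⟨ regroup (w 1) p ρ (p ^ k) m (horner m p k (λ i → w (suc (suc i)))) ⟩
    (p ^ k * w 1 + m * horner m p k (λ i → w (suc (suc i)))) + ρ * p ^ suc k
      ≡⟨ cong (_+ ρ * p ^ suc k) (horner-lowest m p k (λ i → w (suc i))) ⟨
    horner m p (suc k) (λ i → w (suc i)) + ρ * p ^ suc k
      ≡⟨ cong (_+ ρ * p ^ suc k) tail≡ ⟩
    - (ρ * p ^ suc k) + ρ * p ^ suc k
      ≡⟨ ℤ.+-inverseˡ (ρ * p ^ suc k) ⟩
    0ℤ ∎
    where
    regroup : ∀ w₁ p ρ y m h → y * (w₁ + p * ρ) + m * h ≡ (y * w₁ + m * h) + ρ * (p * y)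
    regroup = solve-∀

  quotient : QuotientBy p m k w′
  quotient = px-m-divides B k w′ w′-deg w′-root

  s : ℕ → ℤ
  s zero    = - ρ
  s (suc i) = proj₁ quotient i

  s-deg : ∀ {i} → suc k ℕ.≤ i → s i ≡ 0ℤ
  s-deg {suc i} (s≤s k≤i) = proj₁ (proj₂ quotient) k≤i

  linMul-s : ∀ i → linMul p m s i ≡ w i
  linMul-s zero          = trans (negate m ρ) (sym w₀≡)
    where
    negate : ∀ m ρ → - (m * - ρ) ≡ ρ * m
    negate = solve-∀
  linMul-s (suc zero)    = begin
    p * - ρ + - (m * s 1)    ≡⟨ cong (λ t → p * - ρ + t) (proj₂ (proj₂ quotient) 0) ⟩
    p * - ρ + (w 1 + p * ρ)  ≡⟨ cancel p ρ (w 1) ⟩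
    w 1                      ∎
    where
    cancel : ∀ p ρ w₁ → p * - ρ + (w₁ + p * ρ) ≡ w₁
    cancel = solve-∀
  linMul-s (suc (suc i)) = proj₂ (proj₂ quotient) (suc i)

linMul-cong : ∀ p m {s s′ : ℕ → ℤ} → (∀ i → s i ≡ s′ i) → ∀ i → linMul p m s i ≡ linMul p m s′ i
linMul-cong p m s≗s′ zero    = cong (λ c → - (m * c)) (s≗s′ 0)
linMul-cong p m s≗s′ (suc i) = cong₂ (λ c c′ → p * c - m * c′) (s≗s′ i) (s≗s′ (suc i))

trunc-≥ : ∀ {n} (e : ℕ → ℤ) {i} → n ℕ.≤ i → trunc n e i ≡ 0ℤ
trunc-≥ e n≤i rewrite <ᵇ-false n≤i = refl

extendBy : ∀ n → (ℕ → ℤ) → ℤ → Fin (suc n) → ℤ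
extendBy n s ρ j = if toℕ j <ᵇ n then s (toℕ j) else ρ

ext-extendBy-last : ∀ n (s : ℕ → ℤ) ρ → ext (extendBy n s ρ) n ≡ ρ
ext-extendBy-last n s ρ rewrite ext-fromℕ n (extendBy n s ρ) | Fin.toℕ-fromℕ n | <ᵇ-false (ℕ.≤-refl {n}) = refl

trunc-extendBy : ∀ n (s : ℕ → ℤ) ρ → (∀ {i} → n ℕ.≤ i → s i ≡ 0ℤ) → ∀ i → trunc n (ext (extendBy n s ρ)) i ≡ s i
trunc-extendBy n s ρ s-deg i with i <? n
... | yes i<n rewrite <ᵇ-true i<n | ext-< (extendBy n s ρ) (ℕ.m<n⇒m<1+n i<n)
                    | Fin.toℕ-fromℕ< (ℕ.m<n⇒m<1+n i<n) | <ᵇ-true i<n = refl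
... | no  i≮n = trans (trunc-≥ (ext (extendBy n s ρ)) (ℕ.≮⇒≥ i≮n)) (sym (s-deg (ℕ.≮⇒≥ i≮n)))

cong₃ : ∀ {A B C D : Set} (f : A → B → C → D) {x x′ y y′ z z′} →
        x ≡ x′ → y ≡ y′ → z ≡ z′ → f x y z ≡ f x′ y′ z′
cong₃ f refl refl refl = refl

module _ {m p at q′ kt N : ℤ} {n : ℕ} (m≢0 : m ≢ 0ℤ) (p≢0 : p ≢ 0ℤ)
         (coprime : BézoutIdentity 1ℤ m p) (cofactors : BézoutIdentity 1ℤ q′ at) (ktN≢0 : kt * N ≢ 0ℤ)
         (reduced : q′ * p ^ 2 ≡ at * m ^ suc (suc n) - kt * N)
         (f : Fin (suc (suc (suc n))) → ℤ) (isF : IsFtilde (suc (suc n)) at m p kt N f) where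

  private
    d : ℕ
    d = suc (suc n)

    M : ℤ
    M = m ^ suc n

    orth₁ orth₂ : ℤ → ℤ → ℤ → ℤ
    orth₁ X y z = at * (p * X + y * M) + z * (p * q′)
    orth₂ X y z = at * m * X + y * (p * q′) + z * (m * q′)

    f-gap : ext f (suc n) ≡ 0ℤ
    f-gap = proj₁ (proj₂ isF)

    f-top : ext f d ≡ at
    f-top = trans (ext-fromℕ d f) (proj₁ isF)

    f-root : horner m p (suc n) (ext f) ≡ - q′
    f-root = ℤ.*-cancelˡ-≡ (p * p) _ _ {{≢-nonZero (*-≢0 p≢0 p≢0)}} (begin
      p * p * Xf                                       ≡⟨ expand p Xf M (at * (m * M)) ⟩
      p * (p * Xf + 0ℤ * M) + at * (m * M) - at * (m * M)
        ≡⟨ cong (_- at * (m * M)) (trans (sym (cong₂ (λ c c′ → p * (p * Xf + c * M) + c′ * (m * M)) f-gap f-top)) value) ⟩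
      kt * N - at * (m * M)                            ≡⟨ negate (kt * N) (at * (m * M)) ⟩
      - (at * (m * M) - kt * N)                        ≡⟨ cong -_ reduced ⟨
      - (q′ * (p * (p * 1ℤ)))                          ≡⟨ shuffle q′ p ⟩
      p * p * - q′                                     ∎)
      where
      Xf : ℤ
      Xf = horner m p (suc n) (ext f)
      value : horner m p (suc d) (ext f) ≡ kt * N
      value = trans (sym (homEval-horner m p d f)) (proj₂ (proj₂ isF))
      expand : ∀ p x y c → p * p * x ≡ p * (p * x + 0ℤ * y) + c - c
      expand = solve-∀
      negate : ∀ a b → a - b ≡ - (b - a)
      negate = solve-∀
      shuffle : ∀ q p → - (q * (p * (p * 1ℤ))) ≡ p * p * - q
      shuffle = solve-∀

  module _ (v : Fin (suc d) → ℤ) where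

    private
      X : ℤ
      X = horner m p (suc n) (ext v)

      -- (v_(d−1), v_d, X) is ρ times the corresponding data (0, ã, − q̃) of f̃
      Proportional : ℤ → Set
      Proportional ρ = ext v (suc n) ≡ 0ℤ × ext v d ≡ ρ * at × X ≡ - (ρ * q′)

      Orthogonal : Set
      Orthogonal = inner d v (cvec d at p m q′) ≡ 0ℤ × inner d v (shift (cvec d at p m q′)) ≡ 0ℤ

      inner₁ : inner d v (cvec d at p m q′) ≡ orth₁ X (ext v (suc n)) (ext v d)
      inner₁ = inner-cvec d at p m q′ v

      inner₂ : inner d v (shift (cvec d at p m q′)) ≡ orth₂ X (ext v (suc n)) (ext v d)
      inner₂ = inner-shift-cvec (suc n) at p m q′ v

      orthogonal⇒proportional : Orthogonal → ∃[ ρ ] Proportional ρ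
      orthogonal⇒proportional (o₁ , o₂) = ρ , y≡0 , z≡ , X≡
        where
        y z : ℤ
        y = ext v (suc n)
        z = ext v d

        -- m·orth₁ − p·orth₂ = y (ã m^d − q̃ p²) = y k̃ N
        y≡0 : y ≡ 0ℤ
        y≡0 = i*j≡0⇒j≡0 ktN≢0 (begin
          kt * N * y                                   ≡⟨ cong (_* y) (solve-for (q′ * p ^ 2) (at * m ^ d) reduced) ⟩
          (at * (m * M) - q′ * (p * (p * 1ℤ))) * y     ≡⟨ eliminate at m M q′ p y X z ⟩
          m * orth₁ X y z - p * orth₂ X y z            ≡⟨ cong₂ (λ o o′ → m * o - p * o′) (trans (sym inner₁) o₁) (trans (sym inner₂) o₂) ⟩
          m * 0ℤ - p * 0ℤ                              ≡⟨ vanish m p ⟩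
          0ℤ                                           ∎)
          where
          solve-for : ∀ {c} a b → a ≡ b - c → c ≡ b - a
          solve-for {c} a b a≡b-c = trans (sym (cancel b c)) (cong (λ t → b - t) (sym a≡b-c))
            where
            cancel : ∀ b c → b - (b - c) ≡ c
            cancel = solve-∀
          eliminate : ∀ at m M q′ p y X z →
                      (at * (m * M) - q′ * (p * (p * 1ℤ))) * y
                        ≡ m * (at * (p * X + y * M) + z * (p * q′)) - p * (at * m * X + y * (p * q′) + z * (m * q′))
          eliminate = solve-∀
          vanish : ∀ m p → m * 0ℤ - p * 0ℤ ≡ 0ℤ
          vanish = solve-∀

        kernel : q′ * z + at * X ≡ 0ℤ
        kernel = i*j≡0⇒j≡0 m≢0 (begin
          m * (q′ * z + at * X)                ≡⟨ factor m q′ z at X p ⟩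
          orth₂ X 0ℤ z                         ≡⟨ cong (λ c → orth₂ X c z) y≡0 ⟨
          orth₂ X y z                          ≡⟨ trans (sym inner₂) o₂ ⟩
          0ℤ                                   ∎)
          where
          factor : ∀ m q′ z at X p → m * (q′ * z + at * X) ≡ at * m * X + 0ℤ * (p * q′) + z * (m * q′)
          factor = solve-∀

        ρ : ℤ
        ρ = proj₁ (coprime-kernel cofactors kernel)

        z≡ : z ≡ ρ * at
        z≡ = proj₁ (proj₂ (coprime-kernel cofactors kernel))

        X≡ : X ≡ - (ρ * q′)
        X≡ = proj₂ (proj₂ (coprime-kernel cofactors kernel))

      proportional⇒orthogonal : ∃[ ρ ] Proportional ρ → Orthogonal
      proportional⇒orthogonal (ρ , y≡0 , z≡ , X≡) =
        trans inner₁ (trans (cong₃ orth₁ X≡ y≡0 z≡) (vanish₁ at p ρ q′ M)) ,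
        trans inner₂ (trans (cong₃ orth₂ X≡ y≡0 z≡) (vanish₂ at m ρ q′ p))
        where
        vanish₁ : ∀ at p ρ q′ M → at * (p * - (ρ * q′) + 0ℤ * M) + ρ * at * (p * q′) ≡ 0ℤ
        vanish₁ = solve-∀
        vanish₂ : ∀ at m ρ q′ p → at * m * - (ρ * q′) + 0ℤ * (p * q′) + ρ * at * (m * q′) ≡ 0ℤ
        vanish₂ = solve-∀

      proportional⇒multiple : ∃[ ρ ] Proportional ρ → ∃[ r ] PolyRel d p m f v r
      proportional⇒multiple (ρ , y≡0 , z≡ , X≡) = extendBy n s ρ , relation
        where
        w : ℕ → ℤ
        w i = - ρ * ext f i + ext v i

        w-root : horner m p (suc n) w ≡ 0ℤ
        w-root = begin
          horner m p (suc n) w                  ≡⟨ horner-linear m p (suc n) (- ρ) (ext f) (ext v) ⟩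
          - ρ * horner m p (suc n) (ext f) + X  ≡⟨ cong₂ (λ h h′ → - ρ * h + h′) f-root X≡ ⟩
          - ρ * - q′ + - (ρ * q′)               ≡⟨ vanish ρ q′ ⟩
          0ℤ                                    ∎
          where
          vanish : ∀ ρ q′ → - ρ * - q′ + - (ρ * q′) ≡ 0ℤ
          vanish = solve-∀

        w-deg : ∀ {i} → n ℕ.< i → w i ≡ 0ℤ
        w-deg {i} n<i with ℕ.m≤n⇒m<n∨m≡n n<i
        ... | inj₂ refl = trans (cong₂ (λ c c′ → - ρ * c + c′) f-gap y≡0) (vanish ρ)
          where
          vanish : ∀ ρ → - ρ * 0ℤ + 0ℤ ≡ 0ℤ
          vanish = solve-∀
        ... | inj₁ n+1<i with ℕ.m≤n⇒m<n∨m≡n n+1<i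
        ...   | inj₂ refl = trans (cong₂ (λ c c′ → - ρ * c + c′) f-top z≡) (vanish ρ at)
          where
          vanish : ∀ ρ at → - ρ * at + ρ * at ≡ 0ℤ
          vanish = solve-∀
        ...   | inj₁ d<i = trans (cong₂ (λ c c′ → - ρ * c + c′) (ext-≥ f d<i) (ext-≥ v d<i)) (vanish ρ)
          where
          vanish : ∀ ρ → - ρ * 0ℤ + 0ℤ ≡ 0ℤ
          vanish = solve-∀

        quotient : QuotientBy p m n w
        quotient = px-m-divides coprime n w w-deg w-root

        s : ℕ → ℤ
        s = proj₁ quotient

        relation : PolyRel d p m f v (extendBy n s ρ)
        relation i = sym (begin
          ext (extendBy n s ρ) n * ext f i + linMul p m (trunc n (ext (extendBy n s ρ))) i
            ≡⟨ cong₂ _+_ (cong (_* ext f i) (ext-extendBy-last n s ρ))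
                         (trans (linMul-cong p m (trunc-extendBy n s ρ (proj₁ (proj₂ quotient))) i)
                                (proj₂ (proj₂ quotient) i)) ⟩
          ρ * ext f i + (- ρ * ext f i + ext v i)
            ≡⟨ cancel ρ (ext f i) (ext v i) ⟩
          ext v i ∎)
          where
          cancel : ∀ ρ a b → ρ * a + (- ρ * a + b) ≡ b
          cancel = solve-∀

      multiple⇒proportional : ∃[ r ] PolyRel d p m f v r → ∃[ ρ ] Proportional ρ
      multiple⇒proportional (r , relation) = ρ , y≡0 , z≡ , X≡
        where
        ρ : ℤ
        ρ = ext r n

        s : ℕ → ℤ
        s = trunc n (ext r)

        s-deg : ∀ {i} → n ℕ.≤ i → s i ≡ 0ℤ
        s-deg = trunc-≥ (ext r)

        y≡0 : ext v (suc n) ≡ 0ℤ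
        y≡0 = trans (relation (suc n))
                    (trans (cong₃ (λ c s₀ s₁ → ρ * c + (p * s₀ - m * s₁)) f-gap (s-deg ℕ.≤-refl) (s-deg (ℕ.n≤1+n n)))
                           (vanish ρ p m))
          where
          vanish : ∀ ρ p m → ρ * 0ℤ + (p * 0ℤ - m * 0ℤ) ≡ 0ℤ
          vanish = solve-∀

        z≡ : ext v d ≡ ρ * at
        z≡ = trans (relation d)
                   (trans (cong₃ (λ c s₀ s₁ → ρ * c + (p * s₀ - m * s₁)) f-top (s-deg (ℕ.n≤1+n n))
                                 (s-deg (ℕ.m≤n⇒m≤1+n (ℕ.n≤1+n n))))
                          (simplify ρ at p m))
          where
          simplify : ∀ ρ at p m → ρ * at + (p * 0ℤ - m * 0ℤ) ≡ ρ * at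
          simplify = solve-∀

        X≡ : X ≡ - (ρ * q′)
        X≡ = begin
          X                                            ≡⟨ horner-cong m p (suc n) (λ {i} _ → relation i) ⟩
          horner m p (suc n) (λ i → ρ * ext f i + linMul p m s i)
                                                       ≡⟨ horner-linear m p (suc n) ρ (ext f) (linMul p m s) ⟩
          ρ * horner m p (suc n) (ext f) + horner m p (suc n) (linMul p m s)
                                                       ≡⟨ cong₂ (λ h h′ → ρ * h + h′) f-root (horner-linMul m p n s) ⟩
          ρ * - q′ + - (m ^ suc n * s n)               ≡⟨ cong (λ c → ρ * - q′ + - (m ^ suc n * c)) (s-deg ℕ.≤-refl) ⟩
          ρ * - q′ + - (m ^ suc n * 0ℤ)                ≡⟨ simplify ρ q′ (m ^ suc n) ⟩
          - (ρ * q′)                                   ∎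
          where
          simplify : ∀ ρ q′ x → ρ * - q′ + - (x * 0ℤ) ≡ - (ρ * q′)
          simplify = solve-∀

    orthogonal⇔multiple : (inner d v (cvec d at p m q′) ≡ 0ℤ × inner d v (shift (cvec d at p m q′)) ≡ 0ℤ)
                          ⇔ (∃[ r ] PolyRel d p m f v r)
    orthogonal⇔multiple = mk⇔ (proportional⇒multiple ∘ orthogonal⇒proportional)
                              (proportional⇒orthogonal ∘ multiple⇒proportional)

-- reduce 2x + M modulo 2M
balanced-residue : ∀ x (M : ℕ) .{{_ : ℕ.NonZero M}} →
                   ∃[ c ] (- + M ≤ + 2 * (x - c * + M) × + 2 * (x - c * + M) < + M)
balanced-residue x M = c , lower , upper
  where
  instance
    2M≢0 : ℕ.NonZero (2 ℕ.* M)
    2M≢0 = ℕ.m*n≢0 2 M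
  y c : ℤ
  y = + 2 * x + + M
  c = y ZD./ℕ (2 ℕ.* M)

  r : ℕ
  r = y ZD.%ℕ (2 ℕ.* M)

  2t≡r-M : + 2 * (x - c * + M) ≡ + r - + M
  2t≡r-M = begin
    + 2 * (x - c * + M)                 ≡⟨ expand x c (+ M) ⟩
    y - c * (+ 2 * + M) - + M           ≡⟨ cong (λ D → y - c * D - + M) (ℤ.pos-* 2 M) ⟨
    y - c * + (2 ℕ.* M) - + M           ≡⟨ cong (λ y′ → y′ - c * + (2 ℕ.* M) - + M) (ZD.a≡a%ℕn+[a/ℕn]*n y (2 ℕ.* M)) ⟩
    + r + c * + (2 ℕ.* M) - c * + (2 ℕ.* M) - + M ≡⟨ cancel (+ r) (c * + (2 ℕ.* M)) (+ M) ⟩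
    + r - + M                           ∎
    where
    expand : ∀ x c M → + 2 * (x - c * M) ≡ (+ 2 * x + M) - c * (+ 2 * M) - M
    expand = solve-∀
    cancel : ∀ r z M → r + z - z - M ≡ r - M
    cancel = solve-∀

  lower : - + M ≤ + 2 * (x - c * + M)
  lower = subst₂ _≤_ (ℤ.+-identityˡ (- + M)) (sym 2t≡r-M) (ℤ.+-monoˡ-≤ (- + M) (+≤+ ℕ.z≤n))

  upper : + 2 * (x - c * + M) < + M
  upper = subst₂ _<_ (sym 2t≡r-M) (trans (cong (_- + M) (ℤ.pos-* 2 M)) (halve (+ M)))
                 (ℤ.+-monoˡ-< (- + M) (+<+ (ZD.n%ℕd<d y (2 ℕ.* M))))
    where
    halve : ∀ x → + 2 * x - x ≡ x
    halve = solve-∀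

record BalancedStep (μ p r : ℤ) : Set where
  field
    t a   : ℤ
    lower : - (+ ∣ μ ∣) ≤ + 2 * t
    upper : + 2 * t < + ∣ μ ∣
    exact : μ * a ≡ r + t * p

balanced-step : ∀ {μ p} → μ ≢ 0ℤ → BézoutIdentity 1ℤ μ p → ∀ r → BalancedStep μ p r
balanced-step {μ} {p} μ≢0 (bézoutIdentity u w eq) r = record
  { t = t₀ - c * + ∣ μ ∣ ; a = r * u - c * σ * p ; lower = proj₁ (proj₂ balanced) ; upper = proj₂ (proj₂ balanced)
  ; exact = exact }
  where
  t₀ σ : ℤ
  t₀ = - (r * w)
  σ = proj₁ (abs-multiple μ)

  balanced : ∃[ c ] (- + ∣ μ ∣ ≤ + 2 * (t₀ - c * + ∣ μ ∣) × + 2 * (t₀ - c * + ∣ μ ∣) < + ∣ μ ∣)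
  balanced = balanced-residue t₀ ∣ μ ∣ {{≢-nonZero μ≢0}}

  c : ℤ
  c = proj₁ balanced

  exact₀ : μ * (r * u) ≡ r + t₀ * p
  exact₀ = begin
    μ * (r * u)                    ≡⟨ split μ r u w p ⟩
    r * (u * μ + w * p) + t₀ * p   ≡⟨ cong (λ e → r * e + t₀ * p) eq ⟩
    r * 1ℤ + t₀ * p                ≡⟨ cong (_+ t₀ * p) (ℤ.*-identityʳ r) ⟩
    r + t₀ * p                     ∎
    where
    split : ∀ μ r u w p → μ * (r * u) ≡ r * (u * μ + w * p) + - (r * w) * p
    split = solve-∀

  exact : μ * (r * u - c * σ * p) ≡ r + (t₀ - c * + ∣ μ ∣) * p
  exact = begin
    μ * (r * u - c * σ * p)             ≡⟨ split μ (r * u) c σ p ⟩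
    μ * (r * u) - c * (σ * μ) * p       ≡⟨ cong₂ (λ e σμ → e - c * σμ * p) exact₀ (sym (proj₂ (abs-multiple μ))) ⟩
    r + t₀ * p - c * + ∣ μ ∣ * p        ≡⟨ merge r t₀ p c (+ ∣ μ ∣) ⟩
    r + (t₀ - c * + ∣ μ ∣) * p          ∎
    where
    split : ∀ μ a c σ p → μ * (a - c * σ * p) ≡ μ * a - c * (σ * μ) * p
    split = solve-∀
    merge : ∀ r t p c M → r + t * p - c * M * p ≡ r + (t - c * M) * p
    merge = solve-∀

balanced-unit : ∀ t → - (+ 1) ≤ + 2 * t → + 2 * t < + 1 → t ≡ 0ℤ
balanced-unit (+ zero)  _ _ = refl
balanced-unit (+ suc k) _ (+<+ (s≤s ()))
balanced-unit -[1+ k ]  (-≤- 2k+1≤0) _ with ℕ.≤-trans (ℕ.m≤n+m (1 ℕ.* suc k) k) 2k+1≤0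
... | ()

ext-algOut : ∀ n (A : ℕ → ℤ) {i} → i ℕ.< suc n → ext (algOut n A) i ≡ A i
ext-algOut n A i<1+n = trans (ext-< (algOut n A) i<1+n) (cong A (Fin.toℕ-fromℕ< i<1+n))

module _ {m p K : ℤ} {n j : ℕ} {aIn A R T : ℕ → ℤ} (run : AlgARun m p K n j aIn A R T) where
  open AlgARun run

  algOut-input : ∀ {i} → j ℕ.≤ i → i ℕ.≤ n → ext (algOut n A) i ≡ aIn i
  algOut-input {i} j≤i i≤n = trans (ext-algOut n A (s≤s i≤n)) (inputs i j≤i i≤n)

  run-horner : 0 ℕ.< j → ∀ i → i ℕ.≤ j → horner m p (suc i) A ≡ R i
  run-horner 0<j zero    _      = begin
    p * 0ℤ + A 0 * 1ℤ   ≡⟨ reorder p (A 0) ⟩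
    1ℤ * A 0            ≡⟨ stepA 0 0<j ⟩
    R 0 + T 0 * p       ≡⟨ cong (λ t → R 0 + t * p) (balanced-unit (T 0) (stepTlo 0 0<j) (stepThi 0 0<j)) ⟩
    R 0 + 0ℤ * p        ≡⟨ drop (R 0) p ⟩
    R 0                 ∎
    where
    reorder : ∀ p a → p * 0ℤ + a * 1ℤ ≡ 1ℤ * a
    reorder = solve-∀
    drop : ∀ r p → r + 0ℤ * p ≡ r
    drop = solve-∀
  run-horner 0<j (suc i) i<j = begin
    p * horner m p (suc i) A + A (suc i) * m ^ suc i
      ≡⟨ cong (λ h → p * h + A (suc i) * m ^ suc i) (run-horner 0<j i (ℕ.<⇒≤ i<j)) ⟩
    p * R i + A (suc i) * m ^ suc i
      ≡⟨ cong (_+ A (suc i) * m ^ suc i) (stepR i i<j) ⟩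
    R (suc i) - A (suc i) * m ^ suc i + A (suc i) * m ^ suc i
      ≡⟨ cancel (R (suc i)) (A (suc i) * m ^ suc i) ⟩
    R (suc i) ∎
    where
    cancel : ∀ r x → r - x + x ≡ r
    cancel = solve-∀

  algorithmA-correct : 0 ℕ.< j → j ℕ.≤ n → homEval n (algOut n A) m p ≡ K
  algorithmA-correct 0<j j≤n = begin
    Σ< (suc n) F                                   ≡⟨ cong (λ k → Σ< k F) (ℕ.m+[n∸m]≡n (s≤s j≤n)) ⟨
    Σ< (suc j ℕ.+ (n ∸ j)) F                       ≡⟨ Σ<-+ (suc j) (n ∸ j) F ⟩
    Σ< (suc j) F + Σ< (n ∸ j) (λ t → F (suc j ℕ.+ t))
      ≡⟨ cong₂ _+_ head (Σ<-cong (n ∸ j) (λ t<n-j → cong (λ c → c * _ * _) (tail-input t<n-j))) ⟩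
    p ^ (n ∸ j) * R j + tail                       ≡⟨ cong (_+ tail) (ℤ.*-comm (p ^ (n ∸ j)) (R j)) ⟩
    R j * p ^ (n ∸ j) + tail                       ≡⟨ cong (_+ tail) step1 ⟩
    K - tail + tail                                ≡⟨ cancel K tail ⟩
    K                                              ∎
    where
    F : ℕ → ℤ
    F i = ext (algOut n A) i * m ^ i * p ^ (n ∸ i)
    tail : ℤ
    tail = Σ< (n ∸ j) (λ t → aIn (suc j ℕ.+ t) * m ^ (suc j ℕ.+ t) * p ^ (n ∸ (suc j ℕ.+ t)))

    cancel : ∀ k x → k - x + x ≡ k
    cancel = solve-∀

    tail-input : ∀ {t} → t ℕ.< n ∸ j → ext (algOut n A) (suc j ℕ.+ t) ≡ aIn (suc j ℕ.+ t)
    tail-input {t} t<n-j = algOut-input (ℕ.≤-trans (ℕ.n≤1+n j) (ℕ.m≤m+n (suc j) t)) bound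
      where
      bound : suc j ℕ.+ t ℕ.≤ n
      bound = ℕ.≤-trans (ℕ.≤-reflexive (sym (ℕ.+-suc j t)))
                        (ℕ.≤-trans (ℕ.+-monoʳ-≤ j t<n-j) (ℕ.≤-reflexive (ℕ.m+[n∸m]≡n j≤n)))

    head : Σ< (suc j) F ≡ p ^ (n ∸ j) * R j
    head = begin
      Σ< (suc j) F                                              ≡⟨ Σ<-cong (suc j) term ⟩
      Σ< (suc j) (λ i → p ^ (n ∸ j) * (A i * m ^ i * p ^ (j ∸ i))) ≡⟨ *-Σ< (p ^ (n ∸ j)) (suc j) _ ⟨
      p ^ (n ∸ j) * Σ< (suc j) (λ i → A i * m ^ i * p ^ (j ∸ i))   ≡⟨ cong (p ^ (n ∸ j) *_) (Σ<-horner m p (suc j) A) ⟩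
      p ^ (n ∸ j) * horner m p (suc j) A                          ≡⟨ cong (p ^ (n ∸ j) *_) (run-horner 0<j j ℕ.≤-refl) ⟩
      p ^ (n ∸ j) * R j                                           ∎
      where
      term : ∀ {i} → i ℕ.< suc j → F i ≡ p ^ (n ∸ j) * (A i * m ^ i * p ^ (j ∸ i))
      term {i} (s≤s i≤j) = begin
        ext (algOut n A) i * m ^ i * p ^ (n ∸ i)
          ≡⟨ cong₂ (λ a k → a * m ^ i * p ^ k) (ext-algOut n A (s≤s (ℕ.≤-trans i≤j j≤n))) n∸i≡ ⟩
        A i * m ^ i * p ^ ((n ∸ j) ℕ.+ (j ∸ i))
          ≡⟨ cong (A i * m ^ i *_) (ℤ.^-distribˡ-+-* p (n ∸ j) (j ∸ i)) ⟩
        A i * m ^ i * (p ^ (n ∸ j) * p ^ (j ∸ i))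
          ≡⟨ rotate (A i) (m ^ i) (p ^ (n ∸ j)) (p ^ (j ∸ i)) ⟩
        p ^ (n ∸ j) * (A i * m ^ i * p ^ (j ∸ i)) ∎
        where
        n∸i≡ : n ∸ i ≡ (n ∸ j) ℕ.+ (j ∸ i)
        n∸i≡ = trans (cong (_∸ i) (sym (ℕ.m∸n+n≡m j≤n))) (ℕ.+-∸-assoc (n ∸ j) i≤j)
        rotate : ∀ a b c d → a * b * (c * d) ≡ c * (a * b * d)
        rotate = solve-∀

module _ {m p K : ℤ} {n j : ℕ} {aIn : ℕ → ℤ} (m≢0 : m ≢ 0ℤ) (coprime : BézoutIdentity 1ℤ m p)
         (Rtop carry : ℤ)
         (first : Rtop * p ^ (n ∸ suc j)
                    ≡ K - Σ< (n ∸ suc j) (λ t → aIn (suc (suc j) ℕ.+ t) * m ^ (suc (suc j) ℕ.+ t)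
                                                 * p ^ (n ∸ (suc (suc j) ℕ.+ t))))
         (divisible : p * carry ≡ Rtop - aIn (suc j) * m ^ suc j) where

  private
    step : ∀ i r → BalancedStep (m ^ i) p r
    step i = balanced-step (m≢0 ∘ ℤ.i^n≡0⇒i≡0 m i) (bézout-^ coprime i)

    -- Rfrom k = r_(j + 1 − k): the remainders are produced from the top index j + 1 downwards
    Rfrom : ℕ → ℤ
    Rfrom zero          = Rtop
    Rfrom (suc zero)    = carry
    Rfrom (suc (suc k)) = - BalancedStep.t (step (j ∸ k) (Rfrom (suc k)))

    R T A : ℕ → ℤ
    R i = Rfrom (suc j ∸ i)
    T i = BalancedStep.t (step i (R i))
    A i with i <? suc j
    ... | yes _ = BalancedStep.a (step i (R i))
    ... | no  _ = aIn i

    A-input : ∀ {i} → suc j ℕ.≤ i → A i ≡ aIn i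
    A-input {i} j<i with i <? suc j
    ... | yes i≤j = ⊥-elim (ℕ.<⇒≱ i≤j j<i)
    ... | no  _   = refl

    exact : ∀ {i} → i ℕ.< suc j → m ^ i * A i ≡ R i + T i * p
    exact {i} i≤j with i <? suc j
    ... | yes _   = BalancedStep.exact (step i (R i))
    ... | no  i>j = ⊥-elim (i>j i≤j)

    R-below : ∀ {i} → i ℕ.< j → R i ≡ - T (suc i)
    R-below {i} i<j = begin
      Rfrom (suc j ∸ i)
        ≡⟨ cong Rfrom (trans (ℕ.+-∸-assoc 1 (ℕ.<⇒≤ i<j)) (cong suc (ℕ.+-∸-assoc 1 i<j))) ⟩
      - BalancedStep.t (step (j ∸ (j ∸ suc i)) (Rfrom (suc (j ∸ suc i))))
        ≡⟨ cong₂ (λ l r → - BalancedStep.t (step l r)) (ℕ.m∸[m∸n]≡n i<j) (cong Rfrom (sym (ℕ.+-∸-assoc 1 i<j))) ⟩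
      - T (suc i) ∎

    R-j : R j ≡ carry
    R-j = cong Rfrom (ℕ.m+n∸n≡m 1 j)

    R-j+1 : R (suc j) ≡ Rtop
    R-j+1 = cong Rfrom (ℕ.n∸n≡0 j)

    descend : ∀ i → i ℕ.< suc j → p * R i ≡ R (suc i) - A (suc i) * m ^ suc i
    descend i i≤j with ℕ.m≤n⇒m<n∨m≡n (ℕ.s≤s⁻¹ i≤j)
    ... | inj₁ i<j = begin
      p * R i                                         ≡⟨ cong (p *_) (R-below i<j) ⟩
      p * - T (suc i)                                 ≡⟨ cancel p (R (suc i)) (T (suc i)) ⟩
      R (suc i) - (R (suc i) + T (suc i) * p)         ≡⟨ cong (λ x → R (suc i) - x) (exact (s≤s i<j)) ⟨
      R (suc i) - m ^ suc i * A (suc i)               ≡⟨ cong (λ x → R (suc i) - x) (ℤ.*-comm (m ^ suc i) (A (suc i))) ⟩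
      R (suc i) - A (suc i) * m ^ suc i               ∎
      where
      cancel : ∀ p r t → p * - t ≡ r - (r + t * p)
      cancel = solve-∀
    ... | inj₂ refl = begin
      p * R i                                         ≡⟨ cong (p *_) R-j ⟩
      p * carry                                       ≡⟨ divisible ⟩
      Rtop - aIn (suc i) * m ^ suc i                  ≡⟨ cong₂ (λ r a → r - a * m ^ suc i) R-j+1 (A-input ℕ.≤-refl) ⟨
      R (suc i) - A (suc i) * m ^ suc i               ∎

  algorithmA-run : ∃[ A ] ∃[ R ] ∃[ T ] AlgARun m p K n (suc j) aIn A R T
  algorithmA-run = A , R , T , record
    { inputs    = λ i j<i _ → A-input j<i
    ; step1     = trans (cong (_* p ^ (n ∸ suc j)) R-j+1) first
    ; stepR     = descend
    ; stepTlo   = λ i _ → BalancedStep.lower (step i (R i))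
    ; stepThi   = λ i _ → BalancedStep.upper (step i (R i))
    ; stepTcong = λ i i≤j → ∣⇒∣ᵤ (divides (A i) (trans (ℤ.+-comm (p * T i) (R i))
                    (trans (cong (λ x → R i + x) (ℤ.*-comm p (T i))) (trans (sym (exact i≤j)) (ℤ.*-comm (m ^ i) (A i))))))
    ; stepA     = λ i → exact
    }

scaled-zeros : ∀ {g x y x′ y′} → g ≢ 0ℤ → x ≡ g * x′ → y ≡ g * y′ → (x ≡ 0ℤ × y ≡ 0ℤ) ⇔ (x′ ≡ 0ℤ × y′ ≡ 0ℤ)
scaled-zeros {g} g≢0 x≡ y≡ = mk⇔
  (λ (x≡0 , y≡0) → i*j≡0⇒j≡0 g≢0 (trans (sym x≡) x≡0) , i*j≡0⇒j≡0 g≢0 (trans (sym y≡) y≡0))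
  (λ (x′≡0 , y′≡0) → trans x≡ (trans (cong (g *_) x′≡0) (ℤ.*-zeroʳ g)) ,
                     trans y≡ (trans (cong (g *_) y′≡0) (ℤ.*-zeroʳ g)))

module _ {j : ℕ} {m p at : ℤ} where

  private
    d = suc (suc j)

  inputCoeffs-run : ∀ {K q′} → m ≢ 0ℤ → BézoutIdentity 1ℤ m p → q′ * p ^ 2 ≡ at * m ^ d - K →
                    ∃[ A ] ∃[ R ] ∃[ T ] AlgARun m p K d (suc j) (inputCoeffs d at) A R T
  inputCoeffs-run {K} {q′} m≢0 coprime reduced = algorithmA-run m≢0 coprime (- (p * q′)) (- q′) first carry
    where
    last-input : Σ< 1 (λ t → inputCoeffs d at (d ℕ.+ t) * m ^ (d ℕ.+ t) * p ^ (d ∸ (d ℕ.+ t))) ≡ at * m ^ d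
    last-input rewrite ℕ.+-identityʳ j | ≡ᵇ-true j | ℕ.n∸n≡0 j = trans (ℤ.+-identityˡ _) (ℤ.*-identityʳ (at * m ^ d))

    first : - (p * q′) * p ^ (d ∸ suc j)
              ≡ K - Σ< (d ∸ suc j) (λ t → inputCoeffs d at (d ℕ.+ t) * m ^ (d ℕ.+ t) * p ^ (d ∸ (d ℕ.+ t)))
    first rewrite ℕ.m+n∸n≡m 1 j = begin
      - (p * q′) * (p * 1ℤ)    ≡⟨ shuffle p q′ ⟩
      - (q′ * p ^ 2)           ≡⟨ cong -_ reduced ⟩
      - (at * m ^ d - K)       ≡⟨ negate (at * m ^ d) K ⟩
      K - at * m ^ d           ≡⟨ cong (λ x → K - x) last-input ⟨
      K - Σ< 1 (λ t → inputCoeffs d at (d ℕ.+ t) * m ^ (d ℕ.+ t) * p ^ (d ∸ (d ℕ.+ t))) ∎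
      where
      shuffle : ∀ p q → - (p * q) * (p * 1ℤ) ≡ - (q * (p * (p * 1ℤ)))
      shuffle = solve-∀
      negate : ∀ a b → - (a - b) ≡ b - a
      negate = solve-∀

    carry : p * - q′ ≡ - (p * q′) - inputCoeffs d at (suc j) * m ^ suc j
    carry rewrite ≡ᵇ-false (ℕ.1+n≢n {suc j} ∘ sym) = drop p q′ (m ^ suc j)
      where
      drop : ∀ p q x → p * - q ≡ - (p * q) - 0ℤ * x
      drop = solve-∀

  inputCoeffs-run⇒IsFtilde : ∀ {kt N A R T} → AlgARun m p (kt * N) d (suc j) (inputCoeffs d at) A R T →
                             IsFtilde d at m p kt N (algOut d A)
  inputCoeffs-run⇒IsFtilde {A = A} run =
    trans (sym (ext-fromℕ d (algOut d A)))
          (trans (algOut-input run (ℕ.n≤1+n (suc j)) ℕ.≤-refl) (cong (λ b → if b then at else 0ℤ) (≡ᵇ-true d))) ,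
    trans (algOut-input run ℕ.≤-refl (ℕ.n≤1+n (suc j))) (cong (λ b → if b then at else 0ℤ) (≡ᵇ-false (ℕ.1+n≢n {suc j} ∘ sym))) ,
    algorithmA-correct run (s≤s ℕ.z≤n) (ℕ.n≤1+n (suc j))

divide-common-factor : ∀ {q a k} g q′ at kt {e N p} → g ≢ 0ℤ → q ≡ q′ * g → at * g ≡ a → kt * g ≡ k →
                       q * p ^ 2 ≡ a * e - k * N → q′ * p ^ 2 ≡ at * e - kt * N
divide-common-factor {q} {a} {k} g q′ at kt {e} {N} {p} g≢0 q≡ a≡ k≡ eq =
  ℤ.*-cancelˡ-≡ g _ _ {{≢-nonZero g≢0}} (begin
    g * (q′ * p ^ 2)               ≡⟨ ℤ.*-assoc g q′ (p ^ 2) ⟨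
    g * q′ * p ^ 2                 ≡⟨ cong (_* p ^ 2) (trans (ℤ.*-comm g q′) (sym q≡)) ⟩
    q * p ^ 2                      ≡⟨ eq ⟩
    a * e - k * N                  ≡⟨ cong₂ (λ a k → a * e - k * N) a≡ k≡ ⟨
    at * g * e - kt * g * N        ≡⟨ factor g at e kt N ⟩
    g * (at * e - kt * N)          ∎)
  where
  factor : ∀ g at e kt N → at * g * e - kt * g * N ≡ g * (at * e - kt * N)
  factor = solve-∀

lemma5p1 : (N : ℤ) → 0ℤ < N → (d : ℕ) → 3 ℕ.≤ d →
    (a p m k : ℤ) → a ≢ 0ℤ → p ≢ 0ℤ → m ≢ 0ℤ → k ≢ 0ℤ →
    gcd m p ≡ 1ℤ → gcd (a * p) N ≡ 1ℤ →
    (q : ℤ) → q * p ^ 2 ≡ a * m ^ d - k * N → q ≢ 0ℤ →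
    (at kt : ℤ) → at * gcd a q ≡ a → kt * gcd a q ≡ k →
    ((f : Fin (ℕ.suc d) → ℤ) → IsFtilde d at m p kt N f →
      (v : Fin (ℕ.suc d) → ℤ) →
        ((inner d v (cvec d a p m q) ≡ 0ℤ × inner d v (shift (cvec d a p m q)) ≡ 0ℤ)
          ⇔ (∃[ r ] PolyRel d p m f v r)))
    × (∃[ A ] ∃[ R ] ∃[ T ] AlgARun m p (kt * N) d (d ∸ 1) (inputCoeffs d at) A R T)
    × (∀ A R T → AlgARun m p (kt * N) d (d ∸ 1) (inputCoeffs d at) A R T →
         IsFtilde d at m p kt N (algOut d A))
lemma5p1 N 0<N d@(suc (suc (suc n))) (s≤s (s≤s (s≤s _))) a p m k a≢0 p≢0 m≢0 k≢0 gcd[m,p]≡1 _ q q·p²≡ _ at kt at·g≡a kt·g≡k =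
  (λ f isF v → ⇔.trans (scaled-zeros g≢0 (scaled-inner v) (scaled-shifted-inner v))
                       (orthogonal⇔multiple {kt = kt} {N = N} m≢0 p≢0 coprime cofactors ktN≢0 reduced f isF v)) ,
  inputCoeffs-run {q′ = q′} m≢0 coprime reduced ,
  λ _ _ _ → inputCoeffs-run⇒IsFtilde {kt = kt} {N = N}
  where
  g : ℤ
  g = gcd a q
  g∣q : g ∣ q
  g∣q = ∣ᵤ⇒∣ (gcd[i,j]∣j a q)
  open _∣_ g∣q using (equality) renaming (quotient to q′)

  g≢0 : g ≢ 0ℤ
  g≢0 = a≢0 ∘ gcd[i,j]≡0⇒i≡0 a q

  coprime : BézoutIdentity 1ℤ m p
  coprime = subst (λ g′ → BézoutIdentity g′ m p) gcd[m,p]≡1 (bézout m p)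

  cofactors : BézoutIdentity 1ℤ q′ at
  cofactors = bézout-/ g≢0 (subst₂ (BézoutIdentity g) equality (sym at·g≡a) (bézout-sym (bézout a q)))

  ktN≢0 : kt * N ≢ 0ℤ
  ktN≢0 = *-≢0 kt≢0 N≢0
    where
    kt≢0 : kt ≢ 0ℤ
    kt≢0 kt≡0 = k≢0 (trans (sym kt·g≡k) (trans (cong (_* g) kt≡0) (ℤ.*-zeroˡ g)))
    N≢0 : N ≢ 0ℤ
    N≢0 N≡0 = ℤ.<-irrefl (sym N≡0) 0<N

  reduced : q′ * p ^ 2 ≡ at * m ^ d - kt * N
  reduced = divide-common-factor g q′ at kt {m ^ d} {N} {p} g≢0 equality at·g≡a kt·g≡k q·p²≡

  rescale : ∀ i → cvec d a p m q i ≡ g * cvec d at p m q′ i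
  rescale i = trans (cong₂ (λ x y → cvec d x p m y i) (sym at·g≡a) equality) (cvec-scale d at p m q′ g i)

  scaled-inner : ∀ v → inner d v (cvec d a p m q) ≡ g * inner d v (cvec d at p m q′)
  scaled-inner v = inner-scaled d v g rescale

  scaled-shifted-inner : ∀ v → inner d v (shift (cvec d a p m q)) ≡ g * inner d v (shift (cvec d at p m q′))
  scaled-shifted-inner v = inner-scaled d v g (rescale ∘ suc)
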